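{- Let $\xi$ be a positive integer. Let $G$ be a graph and $\mathcal{E}$ an edge-tangle in $G$ of order at least $\xi+2$. If $Z$ is a subset of $E(G)$ with $\lvert Z \rvert \leq \xi$, then there exists a set of two edges of $G-Z$ with at least one common end that is free with respect to $\mathcal{E}-Z$.
   Context: Graphs are finite and may have loops and parallel edges. An edge-cut of a graph $G$ is an ordered partition $[A,B]$ of $V(G)$ (either part may be empty); its order is the number of edges with one end in $A$ and one end in $B$. An edge-tangle $\mathcal{E}$ in $G$ of order $\theta$ is a set of edge-cuts of $G$ of order less than $\theta$ such that: (E1) for every edge-cut $[A,B]$ of $G$ of order less than $\theta$, either $[A,B] \in \mathcal{E}$ or $[B,A] \in \mathcal{E}$; (E2) if $[A_1,B_1],[A_2,B_2],[A_3,B_3] \in \mathcal{E}$ then $B_1 \cap B_2 \cap B_3 \neq \emptyset$; (E3) if $[A,B] \in \mathcal{E}$ then $G$ has at least $\theta$ edges incident with vertices in $B$. For $X \subseteq E(G)$ and a collection $\mathcal{E}$ of edge-cuts of $G$ of order less than $\theta$, $\mathcal{E}-X$ is the set of edge-cuts $[A,B]$ of $G-X$ of order (in $G-X$) less than $\theta - \lvert X \rvert$ such that $[A,B] \in \mathcal{E}$; if $\mathcal{E}$ is an edge-tangle of order $\theta$ and $\lvert X \rvert < \theta$, then $\mathcal{E}-X$ is an edge-tangle in $G-X$ of order $\theta-\lvert X \rvert$. A subset $Y \subseteq E(G)$ is free with respect to an edge-tangle $\mathcal{E}$ in $G$ if there exist no $W \subseteq Y$ and $[A,B] \in \mathcal{E}-W$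 of order less than $\lvert Y-W \rvert$ such that every edge in $Y-W$ has both ends in $A$. -}

module Defs where

open import Data.Nat using (ℕ; _<_; _≤_; _∸_)
open import Data.Bool using (Bool; true; false; not; _∨_; _xor_)
open import Data.Fin using (Fin)
open import Data.Fin.Subset using (Subset; _∈_; _∉_; _⊆_; ∁; _∩_; _─_; ∣_∣)
open import Data.Vec using (lookup; tabulate)
open import Data.Product using (_×_; ∃; Σ)
open import Data.Sum using (_⊎_)
open import Relation.Nullary using (¬_)

-- A finite multigraph (loops and parallel edges allowed):
-- vertices Fin n, edges Fin m, each edge e has ends end₁ e and end₂ e
-- (a loop has end₁ e ≡ end₂ e; the order of the ends is irrelevant below).
record Graph : Set where
  field
    n    : ℕ
    m    : ℕ
    end₁ : Fin m → Fin n
    end₂ : Fin m → Fin n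
open Graph public

VSet : Graph → Set
VSet G = Subset (n G)

ESet : Graph → Set
ESet G = Subset (m G)

allE : (G : Graph) → ESet G
allE G = tabulate (λ _ → true)

-- An edge-cut [A,B] is represented by A : VSet G, with B = ∁ A.
-- We work in subgraphs G - X represented by their edge set S ⊆ E(G)
-- (the vertex set is always V(G)).

crossing : (G : Graph) → VSet G → ESet G
crossing G A = tabulate (λ e → lookup A (end₁ G e) xor lookup A (end₂ G e))

order : (G : Graph) → ESet G → VSet G → ℕ
order G S A = ∣ S ∩ crossing G A ∣

incident : (G : Graph) → VSet G → ESet G
incident G B = tabulate (λ e → lookup B (end₁ G e) ∨ lookup B (end₂ G e))

Cuts : Graph → Set₁
Cuts G = VSet G → Set

record IsEdgeTangle (G : Graph) (S : ESet G) (θ : ℕ) (𝓔 : Cuts G) : Set where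
  field
    small : ∀ A → 𝓔 A → order G S A < θ
    E1 : ∀ A → order G S A < θ → 𝓔 A ⊎ 𝓔 (∁ A)
    E2 : ∀ A₁ A₂ A₃ → 𝓔 A₁ → 𝓔 A₂ → 𝓔 A₃ →
         ∃ λ v → v ∈ ∁ A₁ × v ∈ ∁ A₂ × v ∈ ∁ A₃
    E3 : ∀ A → 𝓔 A → θ ≤ ∣ S ∩ incident G (∁ A) ∣

minusCuts : (G : Graph) → ESet G → ℕ → Cuts G → ESet G → Cuts G
minusCuts G S θ 𝓔 X A = order G (S ─ X) A < θ ∸ ∣ X ∣ × 𝓔 A

Free : (G : Graph) → (S : ESet G) → (θ : ℕ) → Cuts G → ESet G → Set
Free G S θ 𝓔 Y =
  ¬ (Σ (ESet G) λ W → Σ (VSet G) λ A →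
       W ⊆ Y
     × minusCuts G S θ 𝓔 W A
     × order G (S ─ W) A < ∣ Y ─ W ∣
     × (∀ e → e ∈ Y ─ W → end₁ G e ∈ A × end₂ G e ∈ A))

CommonEnd : (G : Graph) → Fin (m G) → Fin (m G) → Set
CommonEnd G e f =
  (end₁ G e ≡ end₁ G f ⊎ end₁ G e ≡ end₂ G f)
  ⊎ (end₂ G e ≡ end₁ G f ⊎ end₂ G e ≡ end₂ G f)
  where open import Relation.Binary.PropositionalEquality using (_≡_)

-- Deleting the edges of Z turns 𝓔 into an edge-tangle 𝓔 - Z of order at least 2 in
-- G - Z, so it suffices to find two free edges with a common end for a tangle 𝓣 of
-- order at least 2.  Such a tangle has a hub: a vertex h lying on the big side of
-- every member of 𝓣 of order at most 1.  It is found by growing a member X of order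
-- at most 1: all edges leaving X end at one vertex h, and if some small member Y
-- contains h then X ∪ Y is again a small member, strictly larger than X.  By (E3) a
-- hub has degree at least 2, and two edges at the hub are free, since a cut
-- witnessing non-freeness would be a small member of 𝓣 containing the hub.
module Submission where

open import Defs
open import Data.Nat using (ℕ; zero; suc; _≤_; _<_; _+_; _∸_; s≤s; s≤s⁻¹; z≤n; _≤?_)
open import Data.Nat.Properties
  using (≤-refl; ≤-trans; ≤-<-trans; ≤-antisym; ≮⇒≥; m≤n⇒m≤1+n; n≤0⇒n≡0;
         +-suc; +-comm; +-monoʳ-≤; +-monoʳ-<; +-mono-≤; m≤m+n; m≤n+o⇒m∸n≤o; m+n≤o⇒m≤o∸n;
         module ≤-Reasoning)
open import Data.Bool using (true; false; _xor_; _∨_)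
open import Data.Bool.Properties using (∨-zeroʳ)
open import Data.Fin using (Fin; _≟_)
open import Data.Fin.Subset
  using (Subset; inside; outside; _∈_; _∉_; _⊆_; ∁; _∩_; _∪_; _─_; _-_; ⁅_⁆; ∣_∣; ⊥; ⊤; Nonempty)
open import Data.Fin.Subset.Properties
  using (_∈?_; nonempty?; anySubset?; Empty-unique; ∣⊥∣≡0; ∉⊥; ∈⊤; ∣p∣≤n; ∣p∣≡n⇒p≡⊤;
         x∈⁅x⁆; x∈⁅y⁆⇒x≡y; x∉⁅y⁆⇒x≢y; ∣⁅x⁆∣≡1; p⊆q⇒∣p∣≤∣q∣; p⊂q⇒∣p∣<∣q∣; ∣p∩q∣≤∣q∣;
         x∈p∩q⁺; x∈p∩q⁻; x∈p∪q⁺; x∈p∪q⁻; p⊆p∪q; x∈p∧x∉q⇒x∈p─q; p─q⊆p;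
         x∈p∧x≢y⇒x∈p-y; x∈p⇒∣p-x∣<∣p∣; x∈∁p⇒x∉p; x∉∁p⇒x∈p)
open import Data.Vec using ([]; _∷_; there; lookup)
open import Data.Vec.Properties using ([]=⇒lookup; lookup⇒[]=; lookup∘tabulate)
open import Data.Product using (_×_; _,_; Σ; ∃; ∃₂; proj₁; proj₂)
open import Data.Sum using (_⊎_; inj₁; inj₂; [_,_])
open import Data.Empty using (⊥-elim)
open import Function using (_∘_)
open import Relation.Nullary using (¬_; Dec; yes; no; contradiction)
open import Relation.Nullary.Decidable using (_×-dec_)
open import Relation.Binary.PropositionalEquality
  using (_≡_; _≢_; refl; sym; trans; cong; cong₂; subst; subst₂)

private variable
  k : ℕ
  x y : Fin k
  p q : Subset k

-- Finite subsets

∣p∪q∣≤∣p∣+∣q∣ : ∀ (p q : Subset k) → ∣ p ∪ q ∣ ≤ ∣ p ∣ + ∣ q ∣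
∣p∪q∣≤∣p∣+∣q∣ []            []            = z≤n
∣p∪q∣≤∣p∣+∣q∣ (inside  ∷ p) (inside  ∷ q)
  rewrite +-suc ∣ p ∣ ∣ q ∣ = s≤s (m≤n⇒m≤1+n (∣p∪q∣≤∣p∣+∣q∣ p q))
∣p∪q∣≤∣p∣+∣q∣ (inside  ∷ p) (outside ∷ q) = s≤s (∣p∪q∣≤∣p∣+∣q∣ p q)
∣p∪q∣≤∣p∣+∣q∣ (outside ∷ p) (inside  ∷ q)
  rewrite +-suc ∣ p ∣ ∣ q ∣ = s≤s (∣p∪q∣≤∣p∣+∣q∣ p q)
∣p∪q∣≤∣p∣+∣q∣ (outside ∷ p) (outside ∷ q) = ∣p∪q∣≤∣p∣+∣q∣ p q

∣p─q∣+∣p∩q∣≡∣p∣ : ∀ (p q : Subset k) → ∣ p ─ q ∣ + ∣ p ∩ q ∣ ≡ ∣ p ∣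
∣p─q∣+∣p∩q∣≡∣p∣ []            []            = refl
∣p─q∣+∣p∩q∣≡∣p∣ (inside  ∷ p) (inside  ∷ q) =
  trans (+-suc ∣ p ─ q ∣ ∣ p ∩ q ∣) (cong suc (∣p─q∣+∣p∩q∣≡∣p∣ p q))
∣p─q∣+∣p∩q∣≡∣p∣ (inside  ∷ p) (outside ∷ q) =
  cong suc (∣p─q∣+∣p∩q∣≡∣p∣ p q)
∣p─q∣+∣p∩q∣≡∣p∣ (outside ∷ p) (inside  ∷ q) = ∣p─q∣+∣p∩q∣≡∣p∣ p q
∣p─q∣+∣p∩q∣≡∣p∣ (outside ∷ p) (outside ∷ q) = ∣p─q∣+∣p∩q∣≡∣p∣ p q

∣q∣+∣p─q∣≤∣p∣ : q ⊆ p → ∣ q ∣ + ∣ p ─ q ∣ ≤ ∣ p ∣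
∣q∣+∣p─q∣≤∣p∣ {q = q} {p = p} q⊆p = begin
  ∣ q ∣ + ∣ p ─ q ∣     ≤⟨ +-mono-≤ (p⊆q⇒∣p∣≤∣q∣ (λ x∈q → x∈p∩q⁺ (q⊆p x∈q , x∈q))) ≤-refl ⟩
  ∣ p ∩ q ∣ + ∣ p ─ q ∣ ≡⟨ +-comm ∣ p ∩ q ∣ ∣ p ─ q ∣ ⟩
  ∣ p ─ q ∣ + ∣ p ∩ q ∣ ≡⟨ ∣p─q∣+∣p∩q∣≡∣p∣ p q ⟩
  ∣ p ∣                 ∎
  where open ≤-Reasoning

∣p∩r∣≤∣q∣+∣p─q∩r∣ : ∀ (p q r : Subset k) → ∣ p ∩ r ∣ ≤ ∣ q ∣ + ∣ (p ─ q) ∩ r ∣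
∣p∩r∣≤∣q∣+∣p─q∩r∣ p q r =
  ≤-trans (p⊆q⇒∣p∣≤∣q∣ split) (∣p∪q∣≤∣p∣+∣q∣ q ((p ─ q) ∩ r))
  where
  split : p ∩ r ⊆ q ∪ ((p ─ q) ∩ r)
  split {x} x∈p∩r with x∈p∩q⁻ p r x∈p∩r | x ∈? q
  ... | _           , _   | yes x∈q = x∈p∪q⁺ (inj₁ x∈q)
  ... | x∈p , x∈r | no x∉q  = x∈p∪q⁺ (inj₂ (x∈p∩q⁺ (x∈p∧x∉q⇒x∈p─q x∈p x∉q , x∈r)))

∩-monoʳ-⊆ : ∀ (p : Subset k) {q r} → q ⊆ r → p ∩ q ⊆ p ∩ r
∩-monoʳ-⊆ p {q} q⊆r x∈p∩q with x∈p , x∈q ← x∈p∩q⁻ p q x∈p∩q = x∈p∩q⁺ (x∈p , q⊆r x∈q)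

∣⁅x⁆∪⁅y⁆∣≤2 : ∀ (x y : Fin k) → ∣ ⁅ x ⁆ ∪ ⁅ y ⁆ ∣ ≤ 2
∣⁅x⁆∪⁅y⁆∣≤2 x y = subst₂ (λ a b → ∣ ⁅ x ⁆ ∪ ⁅ y ⁆ ∣ ≤ a + b) (∣⁅x⁆∣≡1 x) (∣⁅x⁆∣≡1 y)
                          (∣p∪q∣≤∣p∣+∣q∣ ⁅ x ⁆ ⁅ y ⁆)

x∈⁅y⁆∪⁅z⁆⁻ : ∀ {x y z : Fin k} → x ∈ ⁅ y ⁆ ∪ ⁅ z ⁆ → x ≡ y ⊎ x ≡ z
x∈⁅y⁆∪⁅z⁆⁻ {y = y} {z} x∈ with x∈p∪q⁻ ⁅ y ⁆ ⁅ z ⁆ x∈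
... | inj₁ x∈⁅y⁆ = inj₁ (x∈⁅y⁆⇒x≡y y x∈⁅y⁆)
... | inj₂ x∈⁅z⁆ = inj₂ (x∈⁅y⁆⇒x≡y z x∈⁅z⁆)

x∈p─q⇒x∉q : x ∈ p ─ q → x ∉ q
x∈p─q⇒x∉q {p = _ ∷ _} {q = _ ∷ _} (there x∈p─q) (there x∈q) = x∈p─q⇒x∉q x∈p─q x∈q

1≤∣p∣⇒Nonempty : ∀ (p : Subset k) → 1 ≤ ∣ p ∣ → Nonempty p
1≤∣p∣⇒Nonempty {k} p 1≤∣p∣ with nonempty? p
... | yes ne = ne
... | no ¬ne = contradiction (subst (λ r → 1 ≤ ∣ r ∣) (Empty-unique ¬ne) 1≤∣p∣) 1≰∣⊥∣
  where
  1≰∣⊥∣ : ¬ 1 ≤ ∣ ⊥ {n = k} ∣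
  1≰∣⊥∣ rewrite ∣⊥∣≡0 k = λ ()

x∈p⇒1≤∣p∣ : x ∈ p → 1 ≤ ∣ p ∣
x∈p⇒1≤∣p∣ {x = x} x∈p =
  subst (_≤ _) (∣⁅x⁆∣≡1 x) (p⊆q⇒∣p∣≤∣q∣ (λ y∈⁅x⁆ → subst (_∈ _) (sym (x∈⁅y⁆⇒x≡y x y∈⁅x⁆)) x∈p))

x∈p⇒y∈p⇒x≢y⇒2≤∣p∣ : x ∈ p → y ∈ p → x ≢ y → 2 ≤ ∣ p ∣
x∈p⇒y∈p⇒x≢y⇒2≤∣p∣ x∈p y∈p x≢y =
  ≤-<-trans (x∈p⇒1≤∣p∣ (x∈p∧x≢y⇒x∈p-y y∈p (x≢y ∘ sym))) (x∈p⇒∣p-x∣<∣p∣ x∈p)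

∣p∣≤1⇒x∈p⇒y∈p⇒x≡y : ∣ p ∣ ≤ 1 → x ∈ p → y ∈ p → x ≡ y
∣p∣≤1⇒x∈p⇒y∈p⇒x≡y {x = x} {y = y} ∣p∣≤1 x∈p y∈p with x ≟ y
... | yes x≡y = x≡y
... | no  x≢y = contradiction (≤-trans (x∈p⇒y∈p⇒x≢y⇒2≤∣p∣ x∈p y∈p x≢y) ∣p∣≤1) λ { (s≤s ()) }

2≤∣p∣⇒distinct : ∀ (p : Subset k) → 2 ≤ ∣ p ∣ → ∃₂ λ x y → x ≢ y × x ∈ p × y ∈ p
2≤∣p∣⇒distinct p 2≤∣p∣ =
  let x , x∈p = 1≤∣p∣⇒Nonempty p (≤-trans (s≤s z≤n) 2≤∣p∣)
      y , y∈p-x = 1≤∣p∣⇒Nonempty (p - x) (1≤∣p-x∣ x)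
  in x , y , x∉⁅y⁆⇒x≢y (x∈p─q⇒x∉q y∈p-x) ∘ sym , x∈p , p─q⊆p p ⁅ x ⁆ y∈p-x
  where
  1≤∣p-x∣ : ∀ x → 1 ≤ ∣ p - x ∣
  1≤∣p-x∣ x = s≤s⁻¹ (begin
    2                               ≤⟨ 2≤∣p∣ ⟩
    ∣ p ∣                           ≡⟨ sym (∣p─q∣+∣p∩q∣≡∣p∣ p ⁅ x ⁆) ⟩
    ∣ p - x ∣ + ∣ p ∩ ⁅ x ⁆ ∣       ≤⟨ +-monoʳ-≤ ∣ p - x ∣ ∣p∩⁅x⁆∣≤1 ⟩
    ∣ p - x ∣ + 1                   ≡⟨ +-comm ∣ p - x ∣ 1 ⟩
    suc ∣ p - x ∣                   ∎)
    where
    open ≤-Reasoning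
    ∣p∩⁅x⁆∣≤1 : ∣ p ∩ ⁅ x ⁆ ∣ ≤ 1
    ∣p∩⁅x⁆∣≤1 = subst (∣ p ∩ ⁅ x ⁆ ∣ ≤_) (∣⁅x⁆∣≡1 x) (∣p∩q∣≤∣q∣ p ⁅ x ⁆)

-- Ends, crossing edges and incident edges

IsEnd : (G : Graph) → Fin (n G) → Fin (m G) → Set
IsEnd G v e = end₁ G e ≡ v ⊎ end₂ G e ≡ v

data Joins (G : Graph) (e : Fin (m G)) : Fin (n G) → Fin (n G) → Set where
  forward  : Joins G e (end₁ G e) (end₂ G e)
  backward : Joins G e (end₂ G e) (end₁ G e)

module _ {G : Graph} where

  private variable
    e f : Fin (m G)
    u v w u′ w′ : Fin (n G)
    A B : VSet G

  Joins-sym : Joins G e u w → Joins G e w u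
  Joins-sym forward  = backward
  Joins-sym backward = forward

  Joins⇒IsEnd : Joins G e u w → IsEnd G u e
  Joins⇒IsEnd forward  = inj₁ refl
  Joins⇒IsEnd backward = inj₂ refl

  IsEnd⇒CommonEnd : IsEnd G v e → IsEnd G v f → CommonEnd G e f
  IsEnd⇒CommonEnd (inj₁ e₁≡v) (inj₁ f₁≡v) = inj₁ (inj₁ (trans e₁≡v (sym f₁≡v)))
  IsEnd⇒CommonEnd (inj₁ e₁≡v) (inj₂ f₂≡v) = inj₁ (inj₂ (trans e₁≡v (sym f₂≡v)))
  IsEnd⇒CommonEnd (inj₂ e₂≡v) (inj₁ f₁≡v) = inj₂ (inj₁ (trans e₂≡v (sym f₁≡v)))
  IsEnd⇒CommonEnd (inj₂ e₂≡v) (inj₂ f₂≡v) = inj₂ (inj₂ (trans e₂≡v (sym f₂≡v)))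

  outer-end-unique : Joins G e u w → Joins G e u′ w′ →
                     u ∈ A → w ∉ A → u′ ∈ A → w′ ∉ A → w′ ≡ w
  outer-end-unique forward  forward  _   _ _ _    = refl
  outer-end-unique forward  backward u∈A _ _ w′∉A = contradiction u∈A w′∉A
  outer-end-unique backward forward  u∈A _ _ w′∉A = contradiction u∈A w′∉A
  outer-end-unique backward backward _   _ _ _    = refl

  private
    ∉⇒lookup≡false : ∀ {P : Subset k} → x ∉ P → lookup P x ≡ false
    ∉⇒lookup≡false {x = x} {P} x∉P with lookup P x in eq
    ... | true  = contradiction (lookup⇒[]= x P eq) x∉P
    ... | false = refl

    lookup≡false⇒∉ : ∀ {P : Subset k} → lookup P x ≡ false → x ∉ P
    lookup≡false⇒∉ eq x∈P with () ← trans (sym ([]=⇒lookup x∈P)) eq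

  ∈crossing⁺ : Joins G e u w → u ∈ A → w ∉ A → e ∈ crossing G A
  ∈crossing⁺ {e} {A = A} forward u∈A w∉A =
    lookup⇒[]= e (crossing G A)
      (trans (lookup∘tabulate _ e) (cong₂ _xor_ ([]=⇒lookup u∈A) (∉⇒lookup≡false w∉A)))
  ∈crossing⁺ {e} {A = A} backward u∈A w∉A =
    lookup⇒[]= e (crossing G A)
      (trans (lookup∘tabulate _ e) (cong₂ _xor_ (∉⇒lookup≡false w∉A) ([]=⇒lookup u∈A)))

  ∈crossing⁻ : ∀ A → e ∈ crossing G A → ∃₂ λ u w → Joins G e u w × u ∈ A × w ∉ A
  ∈crossing⁻ {e} A e∈A
    with lookup A (end₁ G e) in a₁ | lookup A (end₂ G e) in a₂
       | trans (sym (lookup∘tabulate _ e)) ([]=⇒lookup e∈A)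
  ... | true  | false | _ = end₁ G e , end₂ G e , forward ,
                            lookup⇒[]= _ A a₁ , lookup≡false⇒∉ a₂
  ... | false | true  | _ = end₂ G e , end₁ G e , backward ,
                            lookup⇒[]= _ A a₂ , lookup≡false⇒∉ a₁

  ∈incident⁺ : v ∈ B → IsEnd G v e → e ∈ incident G B
  ∈incident⁺ {B = B} {e = e} v∈B v-end =
    lookup⇒[]= e (incident G B) (trans (lookup∘tabulate _ e) (some-end∈B v-end))
    where
    some-end∈B : IsEnd G _ e → lookup B (end₁ G e) ∨ lookup B (end₂ G e) ≡ true
    some-end∈B (inj₁ refl) rewrite []=⇒lookup v∈B = refl
    some-end∈B (inj₂ refl) rewrite []=⇒lookup v∈B = ∨-zeroʳ _

  ∈incident⁻ : ∀ B → e ∈ incident G B → ∃ λ v → v ∈ B × IsEnd G v e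
  ∈incident⁻ {e} B e∈B
    with lookup B (end₁ G e) in b₁ | lookup B (end₂ G e) in b₂
       | trans (sym (lookup∘tabulate _ e)) ([]=⇒lookup e∈B)
  ... | true  | _    | _ = end₁ G e , lookup⇒[]= _ B b₁ , inj₁ refl
  ... | false | true | _ = end₂ G e , lookup⇒[]= _ B b₂ , inj₂ refl

  ∈incident-⁅⁆⁻ : e ∈ incident G ⁅ v ⁆ → IsEnd G v e
  ∈incident-⁅⁆⁻ {v = v} e∈ with u , u∈⁅v⁆ , u-end ← ∈incident⁻ ⁅ v ⁆ e∈ =
    subst (λ u → IsEnd G u _) (x∈⁅y⁆⇒x≡y v u∈⁅v⁆) u-end

  incident-mono : A ⊆ B → incident G A ⊆ incident G B
  incident-mono {A} A⊆B e∈A with v , v∈A , v-end ← ∈incident⁻ A e∈A = ∈incident⁺ (A⊆B v∈A) v-end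

  crossing⊆incident : ∀ A → crossing G A ⊆ incident G A
  crossing⊆incident A e∈ with _ , _ , j , u∈A , _ ← ∈crossing⁻ A e∈ = ∈incident⁺ u∈A (Joins⇒IsEnd j)

  crossing-∁⊆ : ∀ A → crossing G (∁ A) ⊆ crossing G A
  crossing-∁⊆ A e∈ with _ , _ , j , u∈∁A , w∉∁A ← ∈crossing⁻ (∁ A) e∈ =
    ∈crossing⁺ (Joins-sym j) (x∉∁p⇒x∈p w∉∁A) (x∈∁p⇒x∉p u∈∁A)

  crossing-⊥ : e ∉ crossing G ⊥
  crossing-⊥ e∈ with _ , _ , _ , u∈⊥ , _ ← ∈crossing⁻ ⊥ e∈ = ∉⊥ u∈⊥

  order-─ : ∀ S X A → order G S A ≤ ∣ X ∣ + order G (S ─ X) A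
  order-─ S X A = ∣p∩r∣≤∣q∣+∣p─q∩r∣ S X (crossing G A)

  order-∁ : ∀ S A → order G S (∁ A) ≤ order G S A
  order-∁ S A = p⊆q⇒∣p∣≤∣q∣ (∩-monoʳ-⊆ S (crossing-∁⊆ A))

  order-⊥ : ∀ S → order G S ⊥ ≡ 0
  order-⊥ S = n≤0⇒n≡0 (subst (order G S ⊥ ≤_) (∣⊥∣≡0 (m G))
    (p⊆q⇒∣p∣≤∣q∣ {q = ⊥} λ e∈ → contradiction (proj₂ (x∈p∩q⁻ S _ e∈)) crossing-⊥))

-- Edge-tangles

m<n∸o⇒o+m<n : ∀ m n o → m < n ∸ o → o + m < n
m<n∸o⇒o+m<n m n       zero    m<n   = m<n
m<n∸o⇒o+m<n m (suc n) (suc o) m<n∸o = s≤s (m<n∸o⇒o+m<n m n o m<n∸o)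

minus-isEdgeTangle : ∀ {G S θ 𝓣} → IsEdgeTangle G S θ 𝓣 → ∀ X →
                     IsEdgeTangle G (S ─ X) (θ ∸ ∣ X ∣) (minusCuts G S θ 𝓣 X)
minus-isEdgeTangle {G} {S} {θ} {𝓣} T X = record
  { small = λ _ → proj₁
  ; E1    = E1′
  ; E2    = λ A₁ A₂ A₃ (_ , 𝓣A₁) (_ , 𝓣A₂) (_ , 𝓣A₃) → E2 A₁ A₂ A₃ 𝓣A₁ 𝓣A₂ 𝓣A₃
  ; E3    = λ A (_ , 𝓣A) →
      m≤n+o⇒m∸n≤o θ ∣ X ∣ (≤-trans (E3 A 𝓣A) (∣p∩r∣≤∣q∣+∣p─q∩r∣ S X (incident G (∁ A))))
  }
  where
  open IsEdgeTangle T using (E1; E2; E3)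

  E1′ : ∀ A → order G (S ─ X) A < θ ∸ ∣ X ∣ →
        minusCuts G S θ 𝓣 X A ⊎ minusCuts G S θ 𝓣 X (∁ A)
  E1′ A small with E1 A (≤-<-trans (order-─ S X A) (m<n∸o⇒o+m<n _ θ ∣ X ∣ small))
  ... | inj₁ 𝓣A  = inj₁ (small , 𝓣A)
  ... | inj₂ 𝓣∁A = inj₂ (≤-<-trans (order-∁ (S ─ X) A) small , 𝓣∁A)

module EdgeTangle {G : Graph} {S : ESet G} {θ : ℕ} {𝓣 : Cuts G}
                  (T : IsEdgeTangle G S θ 𝓣) where

  open IsEdgeTangle T using (E1; E2)

  private variable
    A X Y : VSet G

  big-side-nonempty : 𝓣 A → ∃ λ v → v ∉ A
  big-side-nonempty {A} 𝓣A with v , v∈∁A , _ ← E2 A A A 𝓣A 𝓣A 𝓣A = v , x∈∁p⇒x∉p v∈∁A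

  ¬both-sides : 𝓣 A → ¬ 𝓣 (∁ A)
  ¬both-sides {A} 𝓣A 𝓣∁A with _ , v∈∁A , v∈∁∁A , _ ← E2 A (∁ A) A 𝓣A 𝓣∁A 𝓣A =
    x∈∁p⇒x∉p v∈∁∁A v∈∁A

  member? : order G S A < θ → Dec (𝓣 A)
  member? {A} small with E1 A small
  ... | inj₁ 𝓣A  = yes 𝓣A
  ... | inj₂ 𝓣∁A = no λ 𝓣A → ¬both-sides 𝓣A 𝓣∁A

  ⊥-member : 0 < θ → 𝓣 ⊥
  ⊥-member 0<θ with E1 ⊥ (subst (_< θ) (sym (order-⊥ {G = G} S)) 0<θ)
  ... | inj₁ 𝓣⊥  = 𝓣⊥
  ... | inj₂ 𝓣∁⊥ with v , v∉∁⊥ ← big-side-nonempty 𝓣∁⊥ = contradiction (x∉∁p⇒x∈p v∉∁⊥) ∉⊥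

  ∪-member : 𝓣 X → 𝓣 Y → order G S (X ∪ Y) < θ → 𝓣 (X ∪ Y)
  ∪-member {X} {Y} 𝓣X 𝓣Y small with E1 (X ∪ Y) small
  ... | inj₁ 𝓣X∪Y  = 𝓣X∪Y
  ... | inj₂ 𝓣∁X∪Y with _ , v∈∁X , v∈∁Y , v∈∁∁X∪Y ← E2 X Y (∁ (X ∪ Y)) 𝓣X 𝓣Y 𝓣∁X∪Y =
    ⊥-elim ([ x∈∁p⇒x∉p v∈∁X , x∈∁p⇒x∉p v∈∁Y ] (x∈p∪q⁻ X Y (x∉∁p⇒x∈p (x∈∁p⇒x∉p v∈∁∁X∪Y))))

module TangleOfOrderTwo {G : Graph} {S : ESet G} {θ : ℕ} {𝓣 : Cuts G}
                        (T : IsEdgeTangle G S θ 𝓣) (2≤θ : 2 ≤ θ) where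

  open IsEdgeTangle T using (E1; E3)
  open EdgeTangle T

  private variable
    h : Fin (n G)
    e f : Fin (m G)
    X Y : VSet G

  Small : VSet G → Set
  Small A = order G S A ≤ 1

  Hub : Fin (n G) → Set
  Hub h = ∀ A → 𝓣 A → Small A → h ∉ A

  ExitsAt : VSet G → Fin (n G) → Set
  ExitsAt X h = ∀ {e u w} → e ∈ S → Joins G e u w → u ∈ X → w ∉ X → w ≡ h

  small⇒<θ : ∀ X → Small X → order G S X < θ
  small⇒<θ _ small = ≤-<-trans small 2≤θ

  exit-vertex : 𝓣 X → Small X → ∃ λ h → h ∉ X × ExitsAt X h
  exit-vertex {X} 𝓣X small with nonempty? (S ∩ crossing G X)
  ... | no ∄crossing =
    let v , v∉X = big-side-nonempty 𝓣X in
    v , v∉X , λ e∈S j u∈X w∉X →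
      contradiction (_ , x∈p∩q⁺ (e∈S , ∈crossing⁺ j u∈X w∉X)) ∄crossing
  ... | yes (c , c∈) with _ , c-crosses ← x∈p∩q⁻ S _ c∈
                     with _ , w , c-joins , u∈X , w∉X ← ∈crossing⁻ X c-crosses =
    w , w∉X , λ e∈S j u′∈X w′∉X →
      let e≡c = ∣p∣≤1⇒x∈p⇒y∈p⇒x≡y small (x∈p∩q⁺ (e∈S , ∈crossing⁺ j u′∈X w′∉X)) c∈ in
      outer-end-unique c-joins (subst (λ e → Joins G e _ _) e≡c j) u∈X w∉X u′∈X w′∉X

  order-∪-exits : ExitsAt X h → h ∈ Y → order G S (X ∪ Y) ≤ order G S Y
  order-∪-exits {X} {h} {Y} exits h∈Y = p⊆q⇒∣p∣≤∣q∣ (λ e∈ → crosses-Y (x∈p∩q⁻ S _ e∈))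
    where
    crosses-Y : ∀ {e} → e ∈ S × e ∈ crossing G (X ∪ Y) → e ∈ S ∩ crossing G Y
    crosses-Y (e∈S , e-crosses) with u , w , j , u∈X∪Y , w∉X∪Y ← ∈crossing⁻ (X ∪ Y) e-crosses =
      x∈p∩q⁺ (e∈S , [ inner∈X , inner∈Y ] (x∈p∪q⁻ X Y u∈X∪Y))
      where
      w∉X : w ∉ X
      w∉X = w∉X∪Y ∘ x∈p∪q⁺ ∘ inj₁
      w∉Y : w ∉ Y
      w∉Y = w∉X∪Y ∘ x∈p∪q⁺ ∘ inj₂
      inner∈Y : u ∈ Y → _
      inner∈Y u∈Y = ∈crossing⁺ j u∈Y w∉Y
      inner∈X : u ∈ X → _
      inner∈X u∈X = contradiction (subst (_∈ Y) (sym (exits e∈S j u∈X w∉X)) h∈Y) w∉Y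

  small-member-containing? : ∀ h Y → Dec (𝓣 Y × Small Y × h ∈ Y)
  small-member-containing? h Y with order G S Y ≤? 1
  ... | yes small = member? (small⇒<θ Y small) ×-dec yes small ×-dec h ∈? Y
  ... | no ¬small = no (¬small ∘ proj₁ ∘ proj₂)

  -- Each round adds h ∉ X to X, so k ≥ n - ∣ X ∣ rounds suffice.
  hub-beyond : ∀ k X → n G ≤ k + ∣ X ∣ → 𝓣 X → Small X → ∃ Hub
  hub-beyond k X bound 𝓣X small with exit-vertex 𝓣X small
  ... | h , h∉X , exits with anySubset? (small-member-containing? h)
  ...   | no ∄Y = h , λ Y 𝓣Y smallY h∈Y → ∄Y (Y , 𝓣Y , smallY , h∈Y)
  ...   | yes (Y , 𝓣Y , smallY , h∈Y) with k
  ...     | zero  = contradiction (subst (h ∈_) (sym X≡⊤) ∈⊤) h∉X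
    where
    X≡⊤ : X ≡ ⊤
    X≡⊤ = ∣p∣≡n⇒p≡⊤ (≤-antisym (∣p∣≤n X) bound)
  ...     | suc k = hub-beyond k (X ∪ Y) bound′
                      (∪-member 𝓣X 𝓣Y (small⇒<θ (X ∪ Y) small∪)) small∪
    where
    small∪ : Small (X ∪ Y)
    small∪ = ≤-trans (order-∪-exits {X} {h} {Y} exits h∈Y) smallY
    bound′ : n G ≤ k + ∣ X ∪ Y ∣
    bound′ = ≤-trans bound (subst (_≤ k + ∣ X ∪ Y ∣) (+-suc k ∣ X ∣)
      (+-monoʳ-≤ k (p⊂q⇒∣p∣<∣q∣ (p⊆p∪q Y , h , x∈p∪q⁺ (inj₂ h∈Y) , h∉X))))

  hub : ∃ Hub
  hub = hub-beyond (n G) ⊥ (m≤m+n (n G) ∣ ⊥ {n = n G} ∣) (⊥-member (≤-trans (s≤s z≤n) 2≤θ))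
                   (subst (_≤ 1) (sym (order-⊥ {G = G} S)) z≤n)

  degree≤1⇒¬Hub : ∣ S ∩ incident G ⁅ h ⁆ ∣ ≤ 1 → ¬ Hub h
  degree≤1⇒¬Hub {h} deg≤1 hub-h =
    [ (λ 𝓣⁅h⁆ → hub-h ⁅ h ⁆ 𝓣⁅h⁆ ⁅h⁆-small (x∈⁅x⁆ h))
    , (λ 𝓣∁⁅h⁆ → contradiction (2≤1 𝓣∁⁅h⁆) λ { (s≤s ()) }) ]
    (E1 ⁅ h ⁆ (small⇒<θ ⁅ h ⁆ ⁅h⁆-small))
    where
    ⁅h⁆-small : Small ⁅ h ⁆
    ⁅h⁆-small = ≤-trans (p⊆q⇒∣p∣≤∣q∣ (∩-monoʳ-⊆ S (crossing⊆incident ⁅ h ⁆))) deg≤1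

    ∁∁⁅h⁆-incident⊆ : incident G (∁ (∁ ⁅ h ⁆)) ⊆ incident G ⁅ h ⁆
    ∁∁⁅h⁆-incident⊆ = incident-mono {G = G} {A = ∁ (∁ ⁅ h ⁆)} (x∉∁p⇒x∈p ∘ x∈∁p⇒x∉p)

    2≤1 : 𝓣 (∁ ⁅ h ⁆) → 2 ≤ 1
    2≤1 𝓣∁⁅h⁆ = begin
      2                                  ≤⟨ 2≤θ ⟩
      θ                                  ≤⟨ E3 (∁ ⁅ h ⁆) 𝓣∁⁅h⁆ ⟩
      ∣ S ∩ incident G (∁ (∁ ⁅ h ⁆)) ∣   ≤⟨ p⊆q⇒∣p∣≤∣q∣ (∩-monoʳ-⊆ S ∁∁⁅h⁆-incident⊆) ⟩
      ∣ S ∩ incident G ⁅ h ⁆ ∣           ≤⟨ deg≤1 ⟩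
      1                                  ∎
      where open ≤-Reasoning

  2≤degree : Hub h → 2 ≤ ∣ S ∩ incident G ⁅ h ⁆ ∣
  2≤degree hub-h = ≮⇒≥ λ deg<2 → degree≤1⇒¬Hub (s≤s⁻¹ deg<2) hub-h

  free-at-hub : ∀ {Y} → Hub h → ∣ Y ∣ ≤ 2 → (∀ {g} → g ∈ Y → IsEnd G h g) → Free G S θ 𝓣 Y
  free-at-hub {h} {Y} hub-h ∣Y∣≤2 Y-at-h (W , A , W⊆Y , (_ , 𝓣A) , order<∣Y─W∣ , Y─W⊆A) =
    hub-h A 𝓣A A-small h∈A
    where
    h∈A : h ∈ A
    h∈A with g , g∈Y─W ← 1≤∣p∣⇒Nonempty (Y ─ W) (≤-<-trans z≤n order<∣Y─W∣)
        with Y-at-h (p─q⊆p Y W g∈Y─W) | Y─W⊆A g g∈Y─W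
    ... | inj₁ refl | end₁∈A , _ = end₁∈A
    ... | inj₂ refl | _ , end₂∈A = end₂∈A

    A-small : Small A
    A-small = s≤s⁻¹ (begin-strict
      order G S A                   ≤⟨ order-─ S W A ⟩
      ∣ W ∣ + order G (S ─ W) A     <⟨ +-monoʳ-< ∣ W ∣ order<∣Y─W∣ ⟩
      ∣ W ∣ + ∣ Y ─ W ∣             ≤⟨ ∣q∣+∣p─q∣≤∣p∣ W⊆Y ⟩
      ∣ Y ∣                         ≤⟨ ∣Y∣≤2 ⟩
      2                             ∎)
      where open ≤-Reasoning

  edges-at-hub-free : Hub h → e ∈ S ∩ incident G ⁅ h ⁆ → f ∈ S ∩ incident G ⁅ h ⁆ →
                      e ∈ S × f ∈ S × CommonEnd G e f × Free G S θ 𝓣 (⁅ e ⁆ ∪ ⁅ f ⁆)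
  edges-at-hub-free {h} {e} {f} hub-h e∈ f∈ =
    e∈S , f∈S , IsEnd⇒CommonEnd {G = G} e-at-h f-at-h ,
    free-at-hub {Y = ⁅ e ⁆ ∪ ⁅ f ⁆} hub-h (∣⁅x⁆∪⁅y⁆∣≤2 e f) pair-at-h
    where
    e∈S : e ∈ S
    e∈S = proj₁ (x∈p∩q⁻ S (incident G ⁅ h ⁆) e∈)
    f∈S : f ∈ S
    f∈S = proj₁ (x∈p∩q⁻ S (incident G ⁅ h ⁆) f∈)
    e-at-h : IsEnd G h e
    e-at-h = ∈incident-⁅⁆⁻ (proj₂ (x∈p∩q⁻ S (incident G ⁅ h ⁆) e∈))
    f-at-h : IsEnd G h f
    f-at-h = ∈incident-⁅⁆⁻ (proj₂ (x∈p∩q⁻ S (incident G ⁅ h ⁆) f∈))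
    pair-at-h : ∀ {g} → g ∈ ⁅ e ⁆ ∪ ⁅ f ⁆ → IsEnd G h g
    pair-at-h g∈ with x∈⁅y⁆∪⁅z⁆⁻ g∈
    ... | inj₁ refl = e-at-h
    ... | inj₂ refl = f-at-h

  free-pair-with-common-end :
    Σ (Fin (m G)) λ e → Σ (Fin (m G)) λ f →
      e ≢ f × e ∈ S × f ∈ S × CommonEnd G e f × Free G S θ 𝓣 (⁅ e ⁆ ∪ ⁅ f ⁆)
  free-pair-with-common-end =
    let h , hub-h             = hub
        e , f , e≢f , e∈ , f∈ = 2≤∣p∣⇒distinct (S ∩ incident G ⁅ h ⁆) (2≤degree hub-h)
    in e , f , e≢f , edges-at-hub-free hub-h e∈ f∈

lemma2p11 : (ξ : ℕ) → 1 ≤ ξ → (G : Graph) → (θ : ℕ) → (𝓔 : Cuts G) →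
    IsEdgeTangle G (allE G) θ 𝓔 → ξ + 2 ≤ θ →
    (Z : ESet G) → ∣ Z ∣ ≤ ξ →
    Σ (Fin (m G)) λ e → Σ (Fin (m G)) λ f →
      e ≢ f × e ∉ Z × f ∉ Z × CommonEnd G e f
      × Free G (allE G ─ Z) (θ ∸ ∣ Z ∣) (minusCuts G (allE G) θ 𝓔 Z) (⁅ e ⁆ ∪ ⁅ f ⁆)
lemma2p11 ξ _ G θ 𝓔 T ξ+2≤θ Z ∣Z∣≤ξ =
  let e , f , e≢f , e∈E-Z , f∈E-Z , common-end , free =
        TangleOfOrderTwo.free-pair-with-common-end (minus-isEdgeTangle T Z) 2≤θ∸∣Z∣
  in e , f , e≢f , x∈p─q⇒x∉q e∈E-Z , x∈p─q⇒x∉q f∈E-Z , common-end , free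
  where
  2≤θ∸∣Z∣ : 2 ≤ θ ∸ ∣ Z ∣
  2≤θ∸∣Z∣ = m+n≤o⇒m≤o∸n 2 (≤-trans (+-monoʳ-≤ 2 ∣Z∣≤ξ) (subst (_≤ θ) (+-comm ξ 2) ξ+2≤θ))
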